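{- Let $f(x)$ be a formal power series with integer coefficients and $f(0)=1$, let $A=(f(x),xf(x))$ (an element of the Bell subgroup) with entries $a_{n,k}=[x^n]f(x)(xf(x))^k$, let $\phi(x)$ be the reversion of $x/f(x)$, let $v(x)=xf(x)$ and $\bar v$ its reversion. Let $c(A;1)$ be the lower-triangular matrix with $(n,k)$ entry $a_{2n,n+k}$. Then $$c(A;1)=\left(\phi'(x),\ \phi(x)f(\phi(x))\right)\quad\text{and}\quad c(A;1)^{ -1}=\left(\frac{1}{\phi'\!\left(\frac{\bar v(x)}{f(\bar v(x))}\right)},\ \frac{\bar v(x)}{f(\bar v(x))}\right).$$
   Context: A Riordan array $(d(x),h(x))$, for formal power series $d,h$ with $d(0)\neq 0$, $h(0)=0$, $h'(0)\neq 0$, is the infinite lower-triangular matrix whose $(n,k)$ entry is $[x^n]d(x)h(x)^k$. The reversion $\bar h$ of a power series $h$ with $h(0)=0$, $h'(0)\ne0$ is the power series $u$ with $u(0)=0$ and $h(u(x))=x$. $\phi'$ denotes the derivative of $\phi$. -}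

module Defs where

open import Data.Nat using (ℕ; zero; suc; _∸_; _+_)
open import Data.Integer using (ℤ; +_; _*_) renaming (_+_ to _+ℤ_)
open import Data.Product using (_×_)
open import Relation.Binary.PropositionalEquality using (_≡_)

-- Formal power series with integer coefficients: n ↦ [x^n] a.
Series : Set
Series = ℕ → ℤ

_≈ₛ_ : Series → Series → Set
a ≈ₛ b = ∀ n → a n ≡ b n
infix 4 _≈ₛ_

sumTo : ℕ → (ℕ → ℤ) → ℤ
sumTo zero    g = g 0
sumTo (suc n) g = sumTo n g +ℤ g (suc n)

one : Series
one zero    = + 1
one (suc _) = + 0

X : Series
X (suc zero) = + 1
X _          = + 0

mul : Series → Series → Series
mul a b n = sumTo n (λ i → a i * b (n ∸ i))

pow : Series → ℕ → Series
pow a zero    = one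
pow a (suc k) = mul a (pow a k)

-- composition a(b(x)) (meaningful when b 0 = 0): [x^n] Σ_k a_k b^k
comp : Series → Series → Series
comp a b n = sumTo n (λ k → a k * pow b k n)

deriv : Series → Series
deriv a n = (+ suc n) * a (suc n)

IsReversion : Series → Series → Set
IsReversion h u = (u 0 ≡ + 0) × (comp h u ≈ₛ X)

Matrix : Set
Matrix = ℕ → ℕ → ℤ

_≈ₘ_ : Matrix → Matrix → Set
M ≈ₘ N = ∀ n k → M n k ≡ N n k
infix 4 _≈ₘ_

-- product of lower-triangular infinite matrices: (MN)_{n,k} = Σ_{j=0}^{n} M_{n,j} N_{j,k}
matMul : Matrix → Matrix → Matrix
matMul M N n k = sumTo n (λ j → M n j * N j k)

idMat : Matrix
idMat zero    zero    = + 1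
idMat zero    (suc _) = + 0
idMat (suc _) zero    = + 0
idMat (suc n) (suc k) = idMat n k

riordan : Series → Series → Matrix
riordan d h n k = mul d (pow h k) n

bellA : Series → Matrix
bellA f = riordan f (mul X f)

cA1 : Series → Matrix
cA1 f n k = bellA f (n + n) (n + k)

-- Put v = x f and g = x / f, so that φ is the reversion of g.  With ψ = v̄ / f(v̄) = g(v̄) and
-- d = 1 / φ'(ψ), the Riordan arrays D = (d, ψ) and T = (φ', φ f(φ)) satisfy D T = I by the
-- fundamental theorem of Riordan arrays, since (φ f(φ)) ∘ ψ = v̄ f(v̄) = x.  On the other hand
-- column k of D composed with v is d(v) ψ(v)^k = g' g^k, so (C D)_{n,k} = [x^{2n}] g' g^k f v^n,
-- which for n = k + p equals [x^p] f^{p+1} g'.  Differentiating g f = x gives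
-- f^{p+1} g' + x f^{p-1} f' = f^p, and [x^p] f^p = [x^{p-1}] f^{p-1} f' for p > 0, so this
-- coefficient is δ_{p,0}: C D = I.
-- Consequently C = C (D T) = (C D) T = T, and D C = D T = I.
module Submission where

open import Defs
open import Data.Integer using (ℤ; +_)
open import Data.Product using (_×_)
open import Relation.Binary.PropositionalEquality using (_≡_)

open import Algebra.Bundles using (CommutativeMonoid)
import Algebra.Solver.CommutativeMonoid as CommutativeMonoidSolver
open import Data.Empty using (⊥-elim)
open import Data.Integer using (0ℤ; 1ℤ; _*_; -_; _-_) renaming (_+_ to _+ℤ_)
import Data.Integer.Properties as ℤ
open import Algebra.Properties.AbelianGroup ℤ.+-0-abelianGroup using () renaming (∙-cancelʳ to +ℤ-cancelʳ)
open import Data.Integer.Tactic.RingSolver using (solve-∀)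
open import Data.Nat using (ℕ; zero; suc; _+_; _∸_; _≤_; _<_; _≤?_; _<?_; z≤n; s≤s)
open import Data.Nat.Induction using (<-rec)
open import Data.Nat.Properties
  using ( ≤-refl; ≤-trans; <⇒≤; <-irrefl; <-≤-trans; ≤-pred; m≤n⇒m≤1+n; m≤n⇒m<n∨m≡n
        ; ≮⇒≥; ≰⇒>; m∸n≤m; n∸n≡0; m+n∸m≡n; m+[n∸m]≡n; m∸n+n≡m; m∸[m∸n]≡n; +-∸-assoc
        ; ∸-+-assoc; +-assoc; +-comm; +-suc; +-identityʳ; m≤m+n; +-monoˡ-≤; +-monoˡ-<
        ; +-monoʳ-<; +-cancelˡ-< )
open import Data.Product using (_,_; proj₁; proj₂)
open import Data.Sum using (inj₁; inj₂)
open import Relation.Binary.Bundles using (Setoid)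
import Relation.Binary.Reasoning.Setoid as SetoidReasoning
open import Relation.Binary.PropositionalEquality
  using (refl; sym; trans; cong; cong₂; subst; module ≡-Reasoning)
open import Relation.Nullary using (¬_; yes; no)

-- Finite sums

sumTo-cong-≤ : ∀ n {g h : ℕ → ℤ} → (∀ i → i ≤ n → g i ≡ h i) → sumTo n g ≡ sumTo n h
sumTo-cong-≤ zero    e = e 0 z≤n
sumTo-cong-≤ (suc n) e = cong₂ _+ℤ_ (sumTo-cong-≤ n (λ i p → e i (m≤n⇒m≤1+n p))) (e (suc n) ≤-refl)

sumTo-cong : ∀ n {g h : ℕ → ℤ} → (∀ i → g i ≡ h i) → sumTo n g ≡ sumTo n h
sumTo-cong n e = sumTo-cong-≤ n (λ i _ → e i)

sumTo-zero : ∀ n {g : ℕ → ℤ} → (∀ i → i ≤ n → g i ≡ 0ℤ) → sumTo n g ≡ 0ℤ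
sumTo-zero n {g} e = trans (sumTo-cong-≤ n e) (zeros n)
  where
  zeros : ∀ m → sumTo m (λ _ → 0ℤ) ≡ 0ℤ
  zeros zero    = refl
  zeros (suc m) = cong (_+ℤ 0ℤ) (zeros m)

sumTo-+ : ∀ n (g h : ℕ → ℤ) → sumTo n (λ i → g i +ℤ h i) ≡ sumTo n g +ℤ sumTo n h
sumTo-+ zero    g h = refl
sumTo-+ (suc n) g h =
  trans (cong (_+ℤ (g (suc n) +ℤ h (suc n))) (sumTo-+ n g h))
        (interchange (sumTo n g) (sumTo n h) (g (suc n)) (h (suc n)))
  where
  interchange : ∀ (a b c d : ℤ) → (a +ℤ b) +ℤ (c +ℤ d) ≡ (a +ℤ c) +ℤ (b +ℤ d)
  interchange = solve-∀

neg-distrib-sumTo : ∀ n (g : ℕ → ℤ) → - sumTo n g ≡ sumTo n (λ i → - g i)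
neg-distrib-sumTo zero    g = refl
neg-distrib-sumTo (suc n) g =
  trans (ℤ.neg-distrib-+ (sumTo n g) (g (suc n))) (cong (_+ℤ (- g (suc n))) (neg-distrib-sumTo n g))

*-distribˡ-sumTo : ∀ n c (g : ℕ → ℤ) → c * sumTo n g ≡ sumTo n (λ i → c * g i)
*-distribˡ-sumTo zero    c g = refl
*-distribˡ-sumTo (suc n) c g =
  trans (ℤ.*-distribˡ-+ c (sumTo n g) (g (suc n))) (cong (_+ℤ (c * g (suc n))) (*-distribˡ-sumTo n c g))

*-distribʳ-sumTo : ∀ n c (g : ℕ → ℤ) → sumTo n g * c ≡ sumTo n (λ i → g i * c)
*-distribʳ-sumTo n c g =
  trans (ℤ.*-comm (sumTo n g) c) (trans (*-distribˡ-sumTo n c g) (sumTo-cong n (λ i → ℤ.*-comm c (g i))))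

sumTo-suc-head : ∀ n (g : ℕ → ℤ) → sumTo (suc n) g ≡ g 0 +ℤ sumTo n (λ i → g (suc i))
sumTo-suc-head zero    g = refl
sumTo-suc-head (suc n) g = trans (cong (_+ℤ g (suc (suc n))) (sumTo-suc-head n g)) (ℤ.+-assoc (g 0) _ _)

sumTo-reverse : ∀ n (g : ℕ → ℤ) → sumTo n g ≡ sumTo n (λ i → g (n ∸ i))
sumTo-reverse zero    g = refl
sumTo-reverse (suc n) g =
  trans (cong (_+ℤ g (suc n)) (sumTo-reverse n g))
        (trans (ℤ.+-comm _ (g (suc n))) (sym (sumTo-suc-head n (λ i → g (suc n ∸ i)))))

sumTo-extend : ∀ {n m} (g : ℕ → ℤ) → n ≤ m → (∀ i → n < i → i ≤ m → g i ≡ 0ℤ) → sumTo m g ≡ sumTo n g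
sumTo-extend {m = zero}  g z≤n e = refl
sumTo-extend {m = suc m} g n≤m e with m≤n⇒m<n∨m≡n n≤m
... | inj₂ refl = refl
... | inj₁ n<m  =
  trans (cong₂ _+ℤ_ (sumTo-extend g (≤-pred n<m) (λ i n<i i≤m → e i n<i (m≤n⇒m≤1+n i≤m))) (e (suc m) n<m ≤-refl))
        (ℤ.+-identityʳ _)

sumTo-swap : ∀ n m (F : ℕ → ℕ → ℤ) →
  sumTo n (λ i → sumTo m (F i)) ≡ sumTo m (λ j → sumTo n (λ i → F i j))
sumTo-swap zero    m F = refl
sumTo-swap (suc n) m F =
  trans (cong (_+ℤ sumTo m (F (suc n))) (sumTo-swap n m F)) (sym (sumTo-+ m (λ j → sumTo n (λ i → F i j)) (F (suc n))))

sumTo-single : ∀ n k (g : ℕ → ℤ) → k ≤ n → (∀ i → i ≤ n → ¬ i ≡ k → g i ≡ 0ℤ) → sumTo n g ≡ g k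
sumTo-single n k g k≤n e =
  trans (sumTo-extend g k≤n (λ i k<i i≤n → e i i≤n (λ { refl → <-irrefl refl k<i })))
        (lastTerm k (λ i i<k → e i (≤-trans (<⇒≤ i<k) k≤n) (λ { refl → <-irrefl refl i<k })))
  where
  lastTerm : ∀ m → (∀ i → i < m → g i ≡ 0ℤ) → sumTo m g ≡ g m
  lastTerm zero    _ = refl
  lastTerm (suc m) e′ =
    trans (cong (_+ℤ g (suc m)) (sumTo-zero m (λ i i≤m → e′ i (s≤s i≤m)))) (ℤ.+-identityˡ _)

sumTo-≡⇒≡-at : ∀ n k (g h : ℕ → ℤ) → k ≤ n → (∀ i → i ≤ n → ¬ i ≡ k → g i ≡ h i) →
  sumTo n g ≡ sumTo n h → g k ≡ h k
sumTo-≡⇒≡-at n k g h k≤n e s = ℤ.i-j≡0⇒i≡j (g k) (h k) (begin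
  g k - h k
    ≡⟨ sumTo-single n k (λ i → g i - h i) k≤n (λ i i≤n i≢k → ℤ.i≡j⇒i-j≡0 (e i i≤n i≢k)) ⟨
  sumTo n (λ i → g i +ℤ - h i)
    ≡⟨ sumTo-+ n g (λ i → - h i) ⟩
  sumTo n g +ℤ sumTo n (λ i → - h i)
    ≡⟨ cong (sumTo n g +ℤ_) (neg-distrib-sumTo n h) ⟨
  sumTo n g - sumTo n h
    ≡⟨ ℤ.i≡j⇒i-j≡0 s ⟩
  0ℤ
    ∎)
  where open ≡-Reasoning

sumTo-triangle : ∀ n (G : ℕ → ℕ → ℤ) →
  sumTo n (λ m → sumTo m (λ i → G i m)) ≡ sumTo n (λ i → sumTo (n ∸ i) (λ j → G i (i + j)))
sumTo-triangle zero    G = refl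
sumTo-triangle (suc n) G = begin
  sumTo n (λ m → sumTo m (λ i → G i m)) +ℤ (sumTo n (λ i → G i (suc n)) +ℤ G (suc n) (suc n))
    ≡⟨ cong (_+ℤ (sumTo n (λ i → G i (suc n)) +ℤ G (suc n) (suc n))) (sumTo-triangle n G) ⟩
  R +ℤ (sumTo n (λ i → G i (suc n)) +ℤ G (suc n) (suc n))
    ≡⟨ ℤ.+-assoc R _ _ ⟨
  (R +ℤ sumTo n (λ i → G i (suc n))) +ℤ G (suc n) (suc n)
    ≡⟨ cong₂ _+ℤ_ (sumTo-+ n _ _) diagonal ⟨
  sumTo n (λ i → sumTo (n ∸ i) (λ j → G i (i + j)) +ℤ G i (suc n)) +ℤ sumTo (n ∸ n) (λ j → G (suc n) (suc n + j))
    ≡⟨ cong (_+ℤ sumTo (n ∸ n) (λ j → G (suc n) (suc n + j))) (sumTo-cong-≤ n (λ i i≤n → sym (rowStep i i≤n))) ⟩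
  sumTo (suc n) (λ i → sumTo (suc n ∸ i) (λ j → G i (i + j)))
    ∎
  where
  open ≡-Reasoning
  R = sumTo n (λ i → sumTo (n ∸ i) (λ j → G i (i + j)))
  diagonal : sumTo (n ∸ n) (λ j → G (suc n) (suc n + j)) ≡ G (suc n) (suc n)
  diagonal = trans (cong (λ m → sumTo m (λ j → G (suc n) (suc n + j))) (n∸n≡0 n))
                   (cong (G (suc n)) (+-identityʳ (suc n)))
  rowStep : ∀ i → i ≤ n →
    sumTo (suc n ∸ i) (λ j → G i (i + j)) ≡ sumTo (n ∸ i) (λ j → G i (i + j)) +ℤ G i (suc n)
  rowStep i i≤n rewrite +-∸-assoc 1 i≤n =
    cong (λ m → sumTo (n ∸ i) (λ j → G i (i + j)) +ℤ G i m) (trans (+-suc i (n ∸ i)) (cong suc (m+[n∸m]≡n i≤n)))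

-- Power series

≈ₛ-setoid : Setoid _ _
≈ₛ-setoid = record
  { Carrier       = Series
  ; _≈_           = _≈ₛ_
  ; isEquivalence = record
    { refl  = λ _ → refl
    ; sym   = λ e n → sym (e n)
    ; trans = λ e e′ n → trans (e n) (e′ n)
    }
  }

open Setoid ≈ₛ-setoid using () renaming (refl to ≈ₛ-refl; sym to ≈ₛ-sym; trans to ≈ₛ-trans)
module ≈ₛ-Reasoning = SetoidReasoning ≈ₛ-setoid

add : Series → Series → Series
add a b n = a n +ℤ b n

scale : ℤ → Series → Series
scale c a n = c * a n

add-cong : ∀ {a a′ b b′} → a ≈ₛ a′ → b ≈ₛ b′ → add a b ≈ₛ add a′ b′
add-cong e e′ n = cong₂ _+ℤ_ (e n) (e′ n)

mul-cong : ∀ {a a′ b b′} → a ≈ₛ a′ → b ≈ₛ b′ → mul a b ≈ₛ mul a′ b′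
mul-cong {a} {a′} {b} {b′} e e′ n = sumTo-cong n (λ i → cong₂ _*_ (e i) (e′ (n ∸ i)))

mul-congˡ : ∀ {a a′} b → a ≈ₛ a′ → mul a b ≈ₛ mul a′ b
mul-congˡ {a} {a′} b e = mul-cong {a} {a′} {b} {b} e ≈ₛ-refl

mul-congʳ : ∀ a {b b′} → b ≈ₛ b′ → mul a b ≈ₛ mul a b′
mul-congʳ a {b} {b′} e = mul-cong {a} {a} {b} {b′} ≈ₛ-refl e

mul-comm : ∀ a b → mul a b ≈ₛ mul b a
mul-comm a b n = trans (sumTo-reverse n (λ i → a i * b (n ∸ i))) (sumTo-cong-≤ n (λ i i≤n →
  trans (cong (λ m → a (n ∸ i) * b m) (m∸[m∸n]≡n i≤n)) (ℤ.*-comm (a (n ∸ i)) (b i))))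

mul-assoc : ∀ a b c → mul (mul a b) c ≈ₛ mul a (mul b c)
mul-assoc a b c n = begin
  sumTo n (λ m → sumTo m (λ i → a i * b (m ∸ i)) * c (n ∸ m))
    ≡⟨ sumTo-cong n (λ m → *-distribʳ-sumTo m (c (n ∸ m)) (λ i → a i * b (m ∸ i))) ⟩
  sumTo n (λ m → sumTo m (λ i → a i * b (m ∸ i) * c (n ∸ m)))
    ≡⟨ sumTo-triangle n (λ i m → a i * b (m ∸ i) * c (n ∸ m)) ⟩
  sumTo n (λ i → sumTo (n ∸ i) (λ j → a i * b (i + j ∸ i) * c (n ∸ (i + j))))
    ≡⟨ sumTo-cong n (λ i → sumTo-cong (n ∸ i) (λ j →
         trans (cong₂ (λ x y → a i * b x * c y) (m+n∸m≡n i j) (sym (∸-+-assoc n i j))) (ℤ.*-assoc (a i) _ _))) ⟩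
  sumTo n (λ i → sumTo (n ∸ i) (λ j → a i * (b j * c (n ∸ i ∸ j))))
    ≡⟨ sumTo-cong n (λ i → *-distribˡ-sumTo (n ∸ i) (a i) _) ⟨
  mul a (mul b c) n
    ∎
  where open ≡-Reasoning

mul-distribˡ-add : ∀ a b c → mul a (add b c) ≈ₛ add (mul a b) (mul a c)
mul-distribˡ-add a b c n =
  trans (sumTo-cong n (λ i → ℤ.*-distribˡ-+ (a i) (b (n ∸ i)) (c (n ∸ i)))) (sumTo-+ n _ _)

mul-scaleʳ : ∀ c a b → mul a (scale c b) ≈ₛ scale c (mul a b)
mul-scaleʳ c a b n = trans (sumTo-cong n (λ i → rearrange (a i) (b (n ∸ i)))) (sym (*-distribˡ-sumTo n c _))
  where
  rearrange : ∀ x y → x * (c * y) ≡ c * (x * y)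
  rearrange x y = trans (sym (ℤ.*-assoc x c y)) (trans (cong (_* y) (ℤ.*-comm x c)) (ℤ.*-assoc c x y))

mul-identityˡ : ∀ a → mul one a ≈ₛ a
mul-identityˡ a zero    = ℤ.*-identityˡ (a 0)
mul-identityˡ a (suc n) =
  trans (sumTo-suc-head n (λ i → one i * a (suc n ∸ i)))
        (trans (cong₂ _+ℤ_ (ℤ.*-identityˡ (a (suc n))) (sumTo-zero n (λ _ _ → refl))) (ℤ.+-identityʳ _))

mul-identityʳ : ∀ a → mul a one ≈ₛ a
mul-identityʳ a = ≈ₛ-trans (mul-comm a one) (mul-identityˡ a)

X-off : ∀ i → ¬ i ≡ 1 → X i ≡ 0ℤ
X-off zero          _   = refl
X-off (suc zero)    i≢1 = ⊥-elim (i≢1 refl)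
X-off (suc (suc i)) _   = refl

mul-X-suc : ∀ a n → mul X a (suc n) ≡ a n
mul-X-suc a n =
  trans (sumTo-single (suc n) 1 (λ i → X i * a (suc n ∸ i)) (s≤s z≤n)
          (λ i _ i≢1 → cong (_* a (suc n ∸ i)) (X-off i i≢1)))
        (ℤ.*-identityˡ (a n))

series-commutativeMonoid : CommutativeMonoid _ _
series-commutativeMonoid = record
  { Carrier = Series ; _≈_ = _≈ₛ_ ; _∙_ = mul ; ε = one
  ; isCommutativeMonoid = record
    { isMonoid = record
      { isSemigroup = record
        { isMagma = record
          { isEquivalence = Setoid.isEquivalence ≈ₛ-setoid
          ; ∙-cong = λ {a} {a′} {b} {b′} → mul-cong {a} {a′} {b} {b′} }
        ; assoc = mul-assoc }
      ; identity = mul-identityˡ , mul-identityʳ }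
    ; comm = mul-comm } }

module ⊛-Solver = CommutativeMonoidSolver series-commutativeMonoid

pow-cong : ∀ {a b} k → a ≈ₛ b → pow a k ≈ₛ pow b k
pow-cong zero    e = ≈ₛ-refl
pow-cong (suc k) e = mul-cong e (pow-cong k e)

pow-+ : ∀ a k l → pow a (k + l) ≈ₛ mul (pow a k) (pow a l)
pow-+ a zero    l = ≈ₛ-sym (mul-identityˡ (pow a l))
pow-+ a (suc k) l = ≈ₛ-trans (mul-congʳ a (pow-+ a k l)) (≈ₛ-sym (mul-assoc a (pow a k) (pow a l)))

pow-distrib-mul : ∀ a b k → pow (mul a b) k ≈ₛ mul (pow a k) (pow b k)
pow-distrib-mul a b zero    = ≈ₛ-sym (mul-identityˡ one)
pow-distrib-mul a b (suc k) = ≈ₛ-trans (mul-congʳ (mul a b) (pow-distrib-mul a b k))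
  (⊛-Solver.solve 4 (λ a b c d → (a ⊕ b) ⊕ (c ⊕ d) ⊜ (a ⊕ c) ⊕ (b ⊕ d)) ≈ₛ-refl a b (pow a k) (pow b k))
  where open ⊛-Solver

idMat-diag : ∀ n → idMat n n ≡ 1ℤ
idMat-diag zero    = refl
idMat-diag (suc n) = idMat-diag n

idMat-off : ∀ n k → ¬ n ≡ k → idMat n k ≡ 0ℤ
idMat-off zero    zero    n≢k = ⊥-elim (n≢k refl)
idMat-off zero    (suc k) _   = refl
idMat-off (suc n) zero    _   = refl
idMat-off (suc n) (suc k) n≢k = idMat-off n k (λ n≡k → n≢k (cong suc n≡k))

pow-X : ∀ k n → pow X k n ≡ idMat n k
pow-X zero    zero    = refl
pow-X zero    (suc n) = refl
pow-X (suc k) zero    = refl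
pow-X (suc k) (suc n) = trans (mul-X-suc (pow X k) n) (pow-X k n)

mul-pow-X : ∀ m p a → mul (pow X m) a (m + p) ≡ a p
mul-pow-X zero    p a = mul-identityˡ a p
mul-pow-X (suc m) p a =
  trans (mul-assoc X (pow X m) a (suc (m + p))) (trans (mul-X-suc (mul (pow X m) a) (m + p)) (mul-pow-X m p a))

OrderAtLeast : Series → ℕ → Set
OrderAtLeast a r = ∀ i → i < r → a i ≡ 0ℤ

orderAtLeast-0 : ∀ a → OrderAtLeast a 0
orderAtLeast-0 a i ()

mul-orderAtLeast : ∀ {a b r s} → OrderAtLeast a r → OrderAtLeast b s → OrderAtLeast (mul a b) (r + s)
mul-orderAtLeast {a} {b} {r} {s} oa ob n n<r+s = sumTo-zero n term
  where
  term : ∀ i → i ≤ n → a i * b (n ∸ i) ≡ 0ℤ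
  term i i≤n with i <? r
  ... | yes i<r = cong (_* b (n ∸ i)) (oa i i<r)
  ... | no  i≮r = trans (cong (a i *_) (ob (n ∸ i) n∸i<s)) (ℤ.*-zeroʳ (a i))
    where
    n∸i<s : n ∸ i < s
    n∸i<s = +-cancelˡ-< i (n ∸ i) s
      (subst (_< i + s) (sym (m+[n∸m]≡n i≤n)) (<-≤-trans n<r+s (+-monoˡ-≤ s (≮⇒≥ i≮r))))

pow-orderAtLeast : ∀ {a} k → a 0 ≡ 0ℤ → OrderAtLeast (pow a k) k
pow-orderAtLeast {a} zero    a₀ = orderAtLeast-0 one
pow-orderAtLeast {a} (suc k) a₀ =
  mul-orderAtLeast {a} {pow a k} {1} {k} (λ { zero _ → a₀ ; (suc _) (s≤s ()) }) (pow-orderAtLeast k a₀)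

deriv-cong : ∀ {a b} → a ≈ₛ b → deriv a ≈ₛ deriv b
deriv-cong e n = cong ((+ suc n) *_) (e (suc n))

deriv-X : deriv X ≈ₛ one
deriv-X zero    = refl
deriv-X (suc n) = ℤ.*-zeroʳ (+ suc (suc n))

-- Splitting the factor n + 1 = i + (n + 1 - i) over the i-th summand gives the two Leibniz terms.
deriv-mul : ∀ a b → deriv (mul a b) ≈ₛ add (mul (deriv a) b) (mul a (deriv b))
deriv-mul a b n = begin
  (+ suc n) * sumTo (suc n) T
    ≡⟨ *-distribˡ-sumTo (suc n) (+ suc n) T ⟩
  sumTo (suc n) (λ i → (+ suc n) * T i)
    ≡⟨ sumTo-cong-≤ (suc n) (λ i i≤1+n → trans (cong (_* T i) (split i i≤1+n)) (ℤ.*-distribʳ-+ (T i) (+ i) (+ (suc n ∸ i)))) ⟩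
  sumTo (suc n) (λ i → (+ i) * T i +ℤ (+ (suc n ∸ i)) * T i)
    ≡⟨ sumTo-+ (suc n) (λ i → (+ i) * T i) (λ i → (+ (suc n ∸ i)) * T i) ⟩
  sumTo (suc n) (λ i → (+ i) * T i) +ℤ sumTo (suc n) (λ i → (+ (suc n ∸ i)) * T i)
    ≡⟨ cong₂ _+ℤ_ derivLeft derivRight ⟩
  mul (deriv a) b n +ℤ mul a (deriv b) n
    ∎
  where
  open ≡-Reasoning
  T : ℕ → ℤ
  T i = a i * b (suc n ∸ i)
  split : ∀ i → i ≤ suc n → + suc n ≡ + i +ℤ + (suc n ∸ i)
  split i i≤1+n = trans (cong +_ (sym (m+[n∸m]≡n i≤1+n))) (ℤ.pos-+ i (suc n ∸ i))
  derivLeft : sumTo (suc n) (λ i → (+ i) * T i) ≡ mul (deriv a) b n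
  derivLeft = trans (sumTo-suc-head n (λ i → (+ i) * T i)) (trans (ℤ.+-identityˡ _)
    (sumTo-cong n (λ i → sym (ℤ.*-assoc (+ suc i) (a (suc i)) (b (n ∸ i))))))
  swapFactor : ∀ (x y z : ℤ) → x * (y * z) ≡ y * (x * z)
  swapFactor = solve-∀
  derivRight : sumTo (suc n) (λ i → (+ (suc n ∸ i)) * T i) ≡ mul a (deriv b) n
  derivRight = trans (cong₂ _+ℤ_
    (sumTo-cong-≤ n (λ i i≤n → trans (cong (λ m → (+ m) * (a i * b m)) (+-∸-assoc 1 i≤n))
                                     (swapFactor (+ suc (n ∸ i)) (a i) (b (suc (n ∸ i))))))
    (cong (λ m → (+ m) * T (suc n)) (n∸n≡0 n))) (ℤ.+-identityʳ _)

deriv-pow : ∀ a p → deriv (pow a (suc p)) ≈ₛ scale (+ suc p) (mul (pow a p) (deriv a))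
deriv-pow a zero    n =
  trans (deriv-cong (mul-identityʳ a) n) (sym (trans (ℤ.*-identityˡ _) (mul-identityˡ (deriv a) n)))
deriv-pow a (suc p) n = begin
  deriv (mul a (pow a (suc p))) n
    ≡⟨ deriv-mul a (pow a (suc p)) n ⟩
  mul (deriv a) (pow a (suc p)) n +ℤ mul a (deriv (pow a (suc p))) n
    ≡⟨ cong₂ _+ℤ_ (mul-comm (deriv a) (pow a (suc p)) n) (begin
         mul a (deriv (pow a (suc p))) n                       ≡⟨ mul-congʳ a (deriv-pow a p) n ⟩
         mul a (scale (+ suc p) (mul (pow a p) (deriv a))) n   ≡⟨ mul-scaleʳ (+ suc p) a (mul (pow a p) (deriv a)) n ⟩
         (+ suc p) * mul a (mul (pow a p) (deriv a)) n         ≡⟨ cong ((+ suc p) *_) (mul-assoc a (pow a p) (deriv a) n) ⟨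
         (+ suc p) * Q                                         ∎) ⟩
  Q +ℤ (+ suc p) * Q
    ≡⟨ cong (_+ℤ (+ suc p) * Q) (ℤ.*-identityˡ Q) ⟨
  1ℤ * Q +ℤ (+ suc p) * Q
    ≡⟨ ℤ.*-distribʳ-+ Q 1ℤ (+ suc p) ⟨
  (+ suc (suc p)) * Q
    ∎
  where
  open ≡-Reasoning
  Q = mul (pow a (suc p)) (deriv a) n

-- Composition

-- The truncation at N in the definition of comp is harmless: u^j has order ≥ j.
mul-comp-expand : ∀ q u p → u 0 ≡ 0ℤ → ∀ N → mul (comp q u) p N ≡ sumTo N (λ j → q j * mul (pow u j) p N)
mul-comp-expand q u p u₀ N = begin
  sumTo N (λ m → sumTo m (λ j → q j * pow u j m) * p (N ∸ m))
    ≡⟨ sumTo-cong N (λ m → *-distribʳ-sumTo m (p (N ∸ m)) (λ j → q j * pow u j m)) ⟩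
  sumTo N (λ m → sumTo m (λ j → q j * pow u j m * p (N ∸ m)))
    ≡⟨ sumTo-cong-≤ N (λ m m≤N → sumTo-extend (λ j → q j * pow u j m * p (N ∸ m)) m≤N (λ j m<j _ →
         trans (cong (λ z → q j * z * p (N ∸ m)) (pow-orderAtLeast j u₀ m m<j))
               (cong (_* p (N ∸ m)) (ℤ.*-zeroʳ (q j))))) ⟨
  sumTo N (λ m → sumTo N (λ j → q j * pow u j m * p (N ∸ m)))
    ≡⟨ sumTo-swap N N (λ m j → q j * pow u j m * p (N ∸ m)) ⟩
  sumTo N (λ j → sumTo N (λ m → q j * pow u j m * p (N ∸ m)))
    ≡⟨ sumTo-cong N (λ j → trans (sumTo-cong N (λ m → ℤ.*-assoc (q j) _ _)) (sym (*-distribˡ-sumTo N (q j) _))) ⟩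
  sumTo N (λ j → q j * mul (pow u j) p N)
    ∎
  where open ≡-Reasoning

comp-congˡ : ∀ {a a′} u → a ≈ₛ a′ → comp a u ≈ₛ comp a′ u
comp-congˡ u e N = sumTo-cong N (λ k → cong (_* pow u k N) (e k))

comp-congʳ : ∀ a {u u′} → u ≈ₛ u′ → comp a u ≈ₛ comp a u′
comp-congʳ a e N = sumTo-cong N (λ k → cong (a k *_) (pow-cong k e N))

comp-coeff-0 : ∀ a u → comp a u 0 ≡ a 0
comp-coeff-0 a u = ℤ.*-identityʳ (a 0)

comp-identityʳ : ∀ a → comp a X ≈ₛ a
comp-identityʳ a n = begin
  comp a X n        ≡⟨ sumTo-single n n (λ k → a k * pow X k n) ≤-refl (λ k _ k≢n →
                         trans (cong (a k *_) (trans (pow-X k n) (idMat-off n k (λ n≡k → k≢n (sym n≡k)))))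
                               (ℤ.*-zeroʳ (a k))) ⟩
  a n * pow X n n   ≡⟨ cong (a n *_) (trans (pow-X n n) (idMat-diag n)) ⟩
  a n * 1ℤ          ≡⟨ ℤ.*-identityʳ (a n) ⟩
  a n               ∎
  where open ≡-Reasoning

comp-identityˡ : ∀ u → u 0 ≡ 0ℤ → comp X u ≈ₛ u
comp-identityˡ u u₀ zero    = sym u₀
comp-identityˡ u u₀ (suc n) =
  trans (sumTo-single (suc n) 1 (λ k → X k * pow u k (suc n)) (s≤s z≤n)
          (λ k _ k≢1 → cong (_* pow u k (suc n)) (X-off k k≢1)))
        (trans (ℤ.*-identityˡ _) (mul-identityʳ u (suc n)))

comp-one : ∀ u → comp one u ≈ₛ one
comp-one u zero    = refl
comp-one u (suc n) =
  trans (sumTo-suc-head n (λ k → one k * pow u k (suc n)))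
        (trans (cong (1ℤ * pow u 0 (suc n) +ℤ_) (sumTo-zero n (λ _ _ → refl))) (ℤ.+-identityʳ _))

comp-mul : ∀ a b u → u 0 ≡ 0ℤ → comp (mul a b) u ≈ₛ mul (comp a u) (comp b u)
comp-mul a b u u₀ N = begin
  sumTo N (λ k → sumTo k (λ i → a i * b (k ∸ i)) * pow u k N)
    ≡⟨ sumTo-cong N (λ k → *-distribʳ-sumTo k (pow u k N) (λ i → a i * b (k ∸ i))) ⟩
  sumTo N (λ k → sumTo k (λ i → a i * b (k ∸ i) * pow u k N))
    ≡⟨ sumTo-triangle N (λ i k → a i * b (k ∸ i) * pow u k N) ⟩
  sumTo N (λ i → sumTo (N ∸ i) (λ j → a i * b (i + j ∸ i) * pow u (i + j) N))
    ≡⟨ sumTo-cong N (λ i → sumTo-cong (N ∸ i) (λ j →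
         trans (cong₂ (λ x y → a i * b x * pow u y N) (m+n∸m≡n i j) (+-comm i j)) (ℤ.*-assoc (a i) (b j) _))) ⟩
  sumTo N (λ i → sumTo (N ∸ i) (λ j → a i * (b j * pow u (j + i) N)))
    ≡⟨ sumTo-cong-≤ N (λ i i≤N → sumTo-extend (λ j → a i * (b j * pow u (j + i) N)) (m∸n≤m N i)
         (λ j N∸i<j _ → highTerm i j i≤N N∸i<j)) ⟨
  sumTo N (λ i → sumTo N (λ j → a i * (b j * pow u (j + i) N)))
    ≡⟨ sumTo-cong N (λ i → trans (sym (*-distribˡ-sumTo N (a i) (λ j → b j * pow u (j + i) N))) (cong (a i *_) (inner i))) ⟩
  sumTo N (λ i → a i * mul (pow u i) (comp b u) N)
    ≡⟨ mul-comp-expand a u (comp b u) u₀ N ⟨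
  mul (comp a u) (comp b u) N
    ∎
  where
  open ≡-Reasoning
  highTerm : ∀ i j → i ≤ N → N ∸ i < j → a i * (b j * pow u (j + i) N) ≡ 0ℤ
  highTerm i j i≤N N∸i<j =
    trans (cong (λ z → a i * (b j * z))
                (pow-orderAtLeast (j + i) u₀ N (subst (_< j + i) (m∸n+n≡m i≤N) (+-monoˡ-< i N∸i<j))))
          (trans (cong (a i *_) (ℤ.*-zeroʳ (b j))) (ℤ.*-zeroʳ (a i)))
  inner : ∀ i → sumTo N (λ j → b j * pow u (j + i) N) ≡ mul (pow u i) (comp b u) N
  inner i = begin
    sumTo N (λ j → b j * pow u (j + i) N)           ≡⟨ sumTo-cong N (λ j → cong (b j *_) (pow-+ u j i N)) ⟩
    sumTo N (λ j → b j * mul (pow u j) (pow u i) N) ≡⟨ mul-comp-expand b u (pow u i) u₀ N ⟨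
    mul (comp b u) (pow u i) N                      ≡⟨ mul-comm (comp b u) (pow u i) N ⟩
    mul (pow u i) (comp b u) N                      ∎

comp-pow : ∀ a u → u 0 ≡ 0ℤ → ∀ k → comp (pow a k) u ≈ₛ pow (comp a u) k
comp-pow a u u₀ zero    = comp-one u
comp-pow a u u₀ (suc k) = ≈ₛ-trans (comp-mul a (pow a k) u u₀) (mul-congʳ (comp a u) (comp-pow a u u₀ k))

comp-assoc : ∀ a u w → u 0 ≡ 0ℤ → w 0 ≡ 0ℤ → comp (comp a u) w ≈ₛ comp a (comp u w)
comp-assoc a u w u₀ w₀ N = begin
  sumTo N (λ m → sumTo m (λ k → a k * pow u k m) * pow w m N)
    ≡⟨ sumTo-cong N (λ m → *-distribʳ-sumTo m (pow w m N) (λ k → a k * pow u k m)) ⟩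
  sumTo N (λ m → sumTo m (λ k → a k * pow u k m * pow w m N))
    ≡⟨ sumTo-cong-≤ N (λ m m≤N → sumTo-extend (λ k → a k * pow u k m * pow w m N) m≤N (λ k m<k _ →
         trans (cong (λ z → a k * z * pow w m N) (pow-orderAtLeast k u₀ m m<k))
               (cong (_* pow w m N) (ℤ.*-zeroʳ (a k))))) ⟨
  sumTo N (λ m → sumTo N (λ k → a k * pow u k m * pow w m N))
    ≡⟨ sumTo-swap N N (λ m k → a k * pow u k m * pow w m N) ⟩
  sumTo N (λ k → sumTo N (λ m → a k * pow u k m * pow w m N))
    ≡⟨ sumTo-cong N (λ k → trans (sumTo-cong N (λ m → ℤ.*-assoc (a k) (pow u k m) (pow w m N)))
                                 (sym (*-distribˡ-sumTo N (a k) (λ m → pow u k m * pow w m N)))) ⟩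
  sumTo N (λ k → a k * comp (pow u k) w N)
    ≡⟨ sumTo-cong N (λ k → cong (a k *_) (comp-pow u w w₀ k N)) ⟩
  comp a (comp u w) N
    ∎
  where open ≡-Reasoning

deriv-comp : ∀ a u → u 0 ≡ 0ℤ → deriv (comp a u) ≈ₛ mul (comp (deriv a) u) (deriv u)
deriv-comp a u u₀ n = begin
  (+ suc n) * sumTo (suc n) (λ k → a k * pow u k (suc n))
    ≡⟨ *-distribˡ-sumTo (suc n) (+ suc n) _ ⟩
  sumTo (suc n) (λ k → (+ suc n) * (a k * pow u k (suc n)))
    ≡⟨ sumTo-suc-head n _ ⟩
  (+ suc n) * (a 0 * 0ℤ) +ℤ sumTo n (λ j → (+ suc n) * (a (suc j) * pow u (suc j) (suc n)))
    ≡⟨ cong (_+ℤ sumTo n (λ j → (+ suc n) * (a (suc j) * pow u (suc j) (suc n))))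
            (trans (cong ((+ suc n) *_) (ℤ.*-zeroʳ (a 0))) (ℤ.*-zeroʳ (+ suc n))) ⟩
  0ℤ +ℤ sumTo n (λ j → (+ suc n) * (a (suc j) * pow u (suc j) (suc n)))
    ≡⟨ ℤ.+-identityˡ _ ⟩
  sumTo n (λ j → (+ suc n) * (a (suc j) * pow u (suc j) (suc n)))
    ≡⟨ sumTo-cong n (λ j → powerRule j) ⟩
  sumTo n (λ j → deriv a j * mul (pow u j) (deriv u) n)
    ≡⟨ mul-comp-expand (deriv a) u (deriv u) u₀ n ⟨
  mul (comp (deriv a) u) (deriv u) n
    ∎
  where
  open ≡-Reasoning
  swapFactor : ∀ (x y z : ℤ) → x * (y * z) ≡ y * (x * z)
  swapFactor = solve-∀
  powerRule : ∀ j → (+ suc n) * (a (suc j) * pow u (suc j) (suc n)) ≡ deriv a j * mul (pow u j) (deriv u) n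
  powerRule j = begin
    (+ suc n) * (a (suc j) * pow u (suc j) (suc n))   ≡⟨ swapFactor (+ suc n) (a (suc j)) _ ⟩
    a (suc j) * deriv (pow u (suc j)) n               ≡⟨ cong (a (suc j) *_) (deriv-pow u j n) ⟩
    a (suc j) * ((+ suc j) * mul (pow u j) (deriv u) n) ≡⟨ ℤ.*-assoc (a (suc j)) (+ suc j) _ ⟨
    a (suc j) * (+ suc j) * mul (pow u j) (deriv u) n ≡⟨ cong (_* mul (pow u j) (deriv u) n) (ℤ.*-comm (a (suc j)) (+ suc j)) ⟩
    deriv a j * mul (pow u j) (deriv u) n             ∎

mul-cancelʳ : ∀ a b c → c 0 ≡ 1ℤ → mul a c ≈ₛ mul b c → a ≈ₛ b
mul-cancelʳ a b c c₀ e = <-rec (λ n → a n ≡ b n) step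
  where
  open ≡-Reasoning
  e′ : mul c a ≈ₛ mul c b
  e′ = ≈ₛ-trans (mul-comm c a) (≈ₛ-trans e (mul-comm b c))
  c₀* : ∀ x → c 0 * x ≡ x
  c₀* x = trans (cong (_* x) c₀) (ℤ.*-identityˡ x)
  -- [x^{n+1}] (c a) = c₀ a_{n+1} + (terms involving only a_0, …, a_n)
  step : ∀ n → (∀ {j} → j < n → a j ≡ b j) → a n ≡ b n
  step zero    _  = trans (sym (c₀* (a 0))) (trans (e′ 0) (c₀* (b 0)))
  step (suc n) ih = trans (sym (c₀* (a (suc n)))) (trans (+ℤ-cancelʳ _ _ _ heads) (c₀* (b (suc n))))
    where
    tail≡ : sumTo n (λ i → c (suc i) * a (n ∸ i)) ≡ sumTo n (λ i → c (suc i) * b (n ∸ i))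
    tail≡ = sumTo-cong n (λ i → cong (c (suc i) *_) (ih (s≤s (m∸n≤m n i))))
    heads : c 0 * a (suc n) +ℤ sumTo n (λ i → c (suc i) * a (n ∸ i))
          ≡ c 0 * b (suc n) +ℤ sumTo n (λ i → c (suc i) * a (n ∸ i))
    heads = begin
      c 0 * a (suc n) +ℤ sumTo n (λ i → c (suc i) * a (n ∸ i)) ≡⟨ sumTo-suc-head n (λ i → c i * a (suc n ∸ i)) ⟨
      mul c a (suc n)                                          ≡⟨ e′ (suc n) ⟩
      mul c b (suc n)                                          ≡⟨ sumTo-suc-head n (λ i → c i * b (suc n ∸ i)) ⟩
      c 0 * b (suc n) +ℤ sumTo n (λ i → c (suc i) * b (n ∸ i)) ≡⟨ cong (c 0 * b (suc n) +ℤ_) tail≡ ⟨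
      c 0 * b (suc n) +ℤ sumTo n (λ i → c (suc i) * a (n ∸ i)) ∎

pow-coeff-agree : ∀ {u w} m → (∀ j → j ≤ m → u j ≡ w j) → ∀ k j → j ≤ m → pow u k j ≡ pow w k j
pow-coeff-agree m agree zero    j j≤m = refl
pow-coeff-agree m agree (suc k) j j≤m = sumTo-cong-≤ j (λ i i≤j →
  cong₂ _*_ (agree i (≤-trans i≤j j≤m)) (pow-coeff-agree m agree k (j ∸ i) (≤-trans (m∸n≤m j i) j≤m)))

-- Every summand of [x^{m+1}] u · u^{k+1} involves only u₀, …, u_m, because u₀ = 0.
pow-coeff-agree-suc : ∀ {u w} m → u 0 ≡ 0ℤ → w 0 ≡ 0ℤ → (∀ j → j ≤ m → u j ≡ w j) →
  ∀ k → pow u (suc (suc k)) (suc m) ≡ pow w (suc (suc k)) (suc m)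
pow-coeff-agree-suc {u} {w} m u₀ w₀ agree k = begin
  pow u (suc (suc k)) (suc m)
    ≡⟨ sumTo-suc-head m (λ i → u i * pow u (suc k) (suc m ∸ i)) ⟩
  u 0 * pow u (suc k) (suc m) +ℤ sumTo m (λ i → u (suc i) * pow u (suc k) (m ∸ i))
    ≡⟨ cong₂ _+ℤ_ (trans (cong (_* pow u (suc k) (suc m)) u₀) (sym (cong (_* pow w (suc k) (suc m)) w₀)))
                  (sumTo-cong-≤ m term) ⟩
  w 0 * pow w (suc k) (suc m) +ℤ sumTo m (λ i → w (suc i) * pow w (suc k) (m ∸ i))
    ≡⟨ sumTo-suc-head m (λ i → w i * pow w (suc k) (suc m ∸ i)) ⟨
  pow w (suc (suc k)) (suc m)
    ∎
  where
  open ≡-Reasoning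
  vanishesAt0 : ∀ a → a 0 ≡ 0ℤ → ∀ x → x * pow a (suc k) 0 ≡ 0ℤ
  vanishesAt0 a a₀ x = trans (cong (x *_) (pow-orderAtLeast {a} (suc k) a₀ 0 (s≤s z≤n))) (ℤ.*-zeroʳ x)
  term : ∀ i → i ≤ m → u (suc i) * pow u (suc k) (m ∸ i) ≡ w (suc i) * pow w (suc k) (m ∸ i)
  term i i≤m with m≤n⇒m<n∨m≡n i≤m
  ... | inj₁ i<m  = cong₂ _*_ (agree (suc i) i<m) (pow-coeff-agree m agree (suc k) (m ∸ i) (m∸n≤m m i))
  ... | inj₂ refl rewrite n∸n≡0 i = trans (vanishesAt0 u u₀ (u (suc i))) (sym (vanishesAt0 w w₀ (w (suc i))))

comp-injectiveʳ : ∀ h u w → h 1 ≡ 1ℤ → u 0 ≡ 0ℤ → w 0 ≡ 0ℤ → comp h u ≈ₛ comp h w → u ≈ₛ w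
comp-injectiveʳ h u w h₁ u₀ w₀ e = <-rec (λ n → u n ≡ w n) step
  where
  linearTerm : ∀ a n → h 1 * pow a 1 n ≡ a n
  linearTerm a n = trans (cong (_* pow a 1 n) h₁) (trans (ℤ.*-identityˡ _) (mul-identityʳ a n))
  step : ∀ n → (∀ {j} → j < n → u j ≡ w j) → u n ≡ w n
  step zero    _  = trans u₀ (sym w₀)
  step (suc m) ih = trans (sym (linearTerm u (suc m))) (trans linear≡ (linearTerm w (suc m)))
    where
    agree : ∀ j → j ≤ m → u j ≡ w j
    agree j j≤m = ih (s≤s j≤m)
    otherTerms : ∀ k → k ≤ suc m → ¬ k ≡ 1 → h k * pow u k (suc m) ≡ h k * pow w k (suc m)
    otherTerms zero          _ _   = refl
    otherTerms (suc zero)    _ k≢1 = ⊥-elim (k≢1 refl)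
    otherTerms (suc (suc k)) _ _   = cong (h (suc (suc k)) *_) (pow-coeff-agree-suc m u₀ w₀ agree k)
    linear≡ : h 1 * pow u 1 (suc m) ≡ h 1 * pow w 1 (suc m)
    linear≡ = sumTo-≡⇒≡-at (suc m) 1 (λ k → h k * pow u k (suc m)) (λ k → h k * pow w k (suc m))
                (s≤s z≤n) otherTerms (e (suc m))

reversion-left-inverse : ∀ h u → h 0 ≡ 0ℤ → h 1 ≡ 1ℤ → IsReversion h u → comp u h ≈ₛ X
reversion-left-inverse h u h₀ h₁ (u₀ , hu≈X) = comp-injectiveʳ h (comp u h) X h₁ (trans (comp-coeff-0 u h) u₀) refl (begin
  comp h (comp u h)   ≈⟨ comp-assoc h u h u₀ h₀ ⟨
  comp (comp h u) h   ≈⟨ comp-congˡ h hu≈X ⟩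
  comp X h            ≈⟨ comp-identityˡ h h₀ ⟩
  h                   ≈⟨ comp-identityʳ h ⟨
  comp h X            ∎)
  where open ≈ₛ-Reasoning

-- Lower-triangular matrices and Riordan arrays

LowerTriangular : Matrix → Set
LowerTriangular M = ∀ i j → i < j → M i j ≡ 0ℤ

≈ₘ-setoid : Setoid _ _
≈ₘ-setoid = record
  { Carrier       = Matrix
  ; _≈_           = _≈ₘ_
  ; isEquivalence = record
    { refl  = λ _ _ → refl
    ; sym   = λ e n k → sym (e n k)
    ; trans = λ e e′ n k → trans (e n k) (e′ n k)
    }
  }

open Setoid ≈ₘ-setoid using () renaming (refl to ≈ₘ-refl; trans to ≈ₘ-trans)
module ≈ₘ-Reasoning = SetoidReasoning ≈ₘ-setoid

matMul-cong : ∀ {M M′ P P′} → M ≈ₘ M′ → P ≈ₘ P′ → matMul M P ≈ₘ matMul M′ P′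
matMul-cong e e′ n k = sumTo-cong n (λ j → cong₂ _*_ (e n j) (e′ j k))

-- Only the middle factor needs to be lower triangular: it lets the inner sum stop at the outer index.
matMul-assoc : ∀ M Q P → LowerTriangular Q → matMul (matMul M Q) P ≈ₘ matMul M (matMul Q P)
matMul-assoc M Q P Q-lower n k = begin
  sumTo n (λ j → sumTo n (λ i → M n i * Q i j) * P j k)
    ≡⟨ sumTo-cong n (λ j → *-distribʳ-sumTo n (P j k) (λ i → M n i * Q i j)) ⟩
  sumTo n (λ j → sumTo n (λ i → M n i * Q i j * P j k))
    ≡⟨ sumTo-swap n n (λ j i → M n i * Q i j * P j k) ⟩
  sumTo n (λ i → sumTo n (λ j → M n i * Q i j * P j k))
    ≡⟨ sumTo-cong-≤ n (λ i i≤n → sumTo-extend (λ j → M n i * Q i j * P j k) i≤n (λ j i<j _ →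
         trans (cong (λ z → M n i * z * P j k) (Q-lower i j i<j)) (cong (_* P j k) (ℤ.*-zeroʳ (M n i))))) ⟩
  sumTo n (λ i → sumTo i (λ j → M n i * Q i j * P j k))
    ≡⟨ sumTo-cong n (λ i → trans (sumTo-cong i (λ j → ℤ.*-assoc (M n i) (Q i j) (P j k)))
                                 (sym (*-distribˡ-sumTo i (M n i) (λ j → Q i j * P j k)))) ⟩
  matMul M (matMul Q P) n k
    ∎
  where open ≡-Reasoning

matMul-identityˡ : ∀ M → matMul idMat M ≈ₘ M
matMul-identityˡ M n k =
  trans (sumTo-single n n (λ j → idMat n j * M j k) ≤-refl
          (λ j _ j≢n → cong (_* M j k) (idMat-off n j (λ n≡j → j≢n (sym n≡j)))))
        (trans (cong (_* M n k) (idMat-diag n)) (ℤ.*-identityˡ (M n k)))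

matMul-identityʳ : ∀ M → LowerTriangular M → matMul M idMat ≈ₘ M
matMul-identityʳ M M-lower n k with k ≤? n
... | yes k≤n =
  trans (sumTo-single n k (λ j → M n j * idMat j k) k≤n
          (λ j _ j≢k → trans (cong (M n j *_) (idMat-off j k j≢k)) (ℤ.*-zeroʳ (M n j))))
        (trans (cong (M n k *_) (idMat-diag k)) (ℤ.*-identityʳ (M n k)))
... | no k≰n =
  trans (sumTo-zero n (λ j j≤n → trans (cong (M n j *_) (idMat-off j k (λ { refl → k≰n j≤n }))) (ℤ.*-zeroʳ (M n j))))
        (sym (M-lower n k (≰⇒> k≰n)))

riordan-cong : ∀ {d d′ h h′} → d ≈ₛ d′ → h ≈ₛ h′ → riordan d h ≈ₘ riordan d′ h′
riordan-cong {d} {d′} {h} {h′} e e′ n k = mul-cong {d} {d′} {pow h k} {pow h′ k} e (pow-cong k e′) n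

riordan-lowerTriangular : ∀ d h → h 0 ≡ 0ℤ → LowerTriangular (riordan d h)
riordan-lowerTriangular d h h₀ n k =
  mul-orderAtLeast {d} {pow h k} {0} {k} (orderAtLeast-0 d) (pow-orderAtLeast k h₀) n

riordan-identity : riordan one X ≈ₘ idMat
riordan-identity n k = trans (mul-identityˡ (pow X k) n) (pow-X k n)

riordan-matMul : ∀ a b c e → b 0 ≡ 0ℤ →
  matMul (riordan a b) (riordan c e) ≈ₘ riordan (mul a (comp c b)) (comp e b)
riordan-matMul a b c e b₀ n k = begin
  sumTo n (λ j → mul a (pow b j) n * column j)
    ≡⟨ sumTo-cong n (λ j → trans (ℤ.*-comm (mul a (pow b j) n) (column j)) (cong (column j *_) (mul-comm a (pow b j) n))) ⟩
  sumTo n (λ j → column j * mul (pow b j) a n)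
    ≡⟨ mul-comp-expand column b a b₀ n ⟨
  mul (comp column b) a n
    ≡⟨ mul-comm (comp column b) a n ⟩
  mul a (comp column b) n
    ≡⟨ mul-congʳ a (≈ₛ-trans (comp-mul c (pow e k) b b₀) (mul-congʳ (comp c b) (comp-pow e b b₀ k))) n ⟩
  mul a (mul (comp c b) (pow (comp e b) k)) n
    ≡⟨ mul-assoc a (comp c b) (pow (comp e b) k) n ⟨
  riordan (mul a (comp c b)) (comp e b) n k
    ∎
  where
  open ≡-Reasoning
  column : Series
  column = mul c (pow e k)

idMat-+ : ∀ k p → idMat (k + p) k ≡ one p
idMat-+ zero    zero    = refl
idMat-+ zero    (suc p) = refl
idMat-+ (suc k) p       = idMat-+ k p

cA1-lowerTriangular : ∀ f → LowerTriangular (cA1 f)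
cA1-lowerTriangular f n k n<k =
  mul-orderAtLeast {f} {pow (mul X f) (n + k)} {0} {n + k} (orderAtLeast-0 f) (pow-orderAtLeast (n + k) refl)
    (n + n) (+-monoʳ-< n n<k)

-- Since C_{n,j} = [x^{2n}] (x f)^j · f (x f)^n, row n of C D is the composite of column k of D with x f.
cA1-matMul-riordan : ∀ f d ψ n k →
  matMul (cA1 f) (riordan d ψ) n k ≡ mul (comp (mul d (pow ψ k)) (mul X f)) (mul f (pow (mul X f) n)) (n + n)
cA1-matMul-riordan f d ψ n k = begin
  sumTo n (λ j → mul f (pow v (n + j)) (n + n) * column j)
    ≡⟨ sumTo-cong n (λ j → trans (ℤ.*-comm (mul f (pow v (n + j)) (n + n)) (column j))
                                 (cong (column j *_) (splitRow j (n + n)))) ⟩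
  sumTo n (λ j → column j * mul (pow v j) row (n + n))
    ≡⟨ sumTo-extend (λ j → column j * mul (pow v j) row (n + n)) (m≤m+n n n) (λ j n<j _ →
         trans (cong (column j *_) (mul-orderAtLeast {pow v j} {row} {j} {n} (pow-orderAtLeast j refl) row-order
                                      (n + n) (+-monoˡ-< n n<j)))
               (ℤ.*-zeroʳ (column j))) ⟨
  sumTo (n + n) (λ j → column j * mul (pow v j) row (n + n))
    ≡⟨ mul-comp-expand column v row refl (n + n) ⟨
  mul (comp column v) row (n + n)
    ∎
  where
  open ≡-Reasoning
  v column row : Series
  v      = mul X f
  column = mul d (pow ψ k)
  row    = mul f (pow v n)
  row-order : OrderAtLeast row n
  row-order = mul-orderAtLeast {f} {pow v n} {0} {n} (orderAtLeast-0 f) (pow-orderAtLeast n refl)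
  splitRow : ∀ j → mul f (pow v (n + j)) ≈ₛ mul (pow v j) row
  splitRow j = ≈ₛ-trans (mul-congʳ f (pow-+ v n j))
                        (≈ₛ-trans (≈ₛ-sym (mul-assoc f (pow v n) (pow v j))) (mul-comm row (pow v j)))

x-over-f-low-coeffs : ∀ f g → f 0 ≡ 1ℤ → mul g f ≈ₛ X → g 0 ≡ 0ℤ × g 1 ≡ 1ℤ
x-over-f-low-coeffs f g f₀ gf≈X = g₀ , g₁
  where
  g₀ : g 0 ≡ 0ℤ
  g₀ = trans (sym (ℤ.*-identityʳ (g 0))) (trans (cong (g 0 *_) (sym f₀)) (gf≈X 0))
  g₁ : g 1 ≡ 1ℤ
  g₁ = trans (sym (trans (cong₂ _+ℤ_ (cong (_* f 1) g₀) (trans (cong (g 1 *_) f₀) (ℤ.*-identityʳ (g 1))))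
                         (ℤ.+-identityˡ (g 1))))
             (gf≈X 1)

-- Multiply the derivative of g f = x, namely g' f + g f' = 1, by f^{q+1}, and use g f = x in the second term.
pow-mul-deriv-x-over-f : ∀ f g → mul g f ≈ₛ X → ∀ q →
  add (mul (pow f (suc (suc q))) (deriv g)) (mul X (mul (pow f q) (deriv f))) ≈ₛ pow f (suc q)
pow-mul-deriv-x-over-f f g gf≈X q = begin
  add (mul (mul f F) (deriv g)) (mul X (mul (pow f q) (deriv f)))
    ≈⟨ add-cong (solve 3 (λ f F g′ → (f ⊕ F) ⊕ g′ ⊜ F ⊕ (g′ ⊕ f)) ≈ₛ-refl f F (deriv g))
                (≈ₛ-trans (mul-congˡ (mul (pow f q) (deriv f)) (≈ₛ-sym gf≈X))
                          (solve 4 (λ g f fq f′ → (g ⊕ f) ⊕ (fq ⊕ f′) ⊜ (f ⊕ fq) ⊕ (g ⊕ f′)) ≈ₛ-refl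
                             g f (pow f q) (deriv f))) ⟩
  add (mul F (mul (deriv g) f)) (mul F (mul g (deriv f)))
    ≈⟨ mul-distribˡ-add F (mul (deriv g) f) (mul g (deriv f)) ⟨
  mul F (add (mul (deriv g) f) (mul g (deriv f)))
    ≈⟨ mul-congʳ F (deriv-mul g f) ⟨
  mul F (deriv (mul g f))
    ≈⟨ mul-congʳ F (≈ₛ-trans (deriv-cong gf≈X) deriv-X) ⟩
  mul F one
    ≈⟨ mul-identityʳ F ⟩
  F
    ∎
  where
  open ≈ₛ-Reasoning
  open ⊛-Solver
  F : Series
  F = pow f (suc q)

pow-mul-deriv-x-over-f-coeff : ∀ f g → f 0 ≡ 1ℤ → mul g f ≈ₛ X → ∀ p → mul (pow f (suc p)) (deriv g) p ≡ one p
pow-mul-deriv-x-over-f-coeff f g f₀ gf≈X zero =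
  cong₂ _*_ (trans (ℤ.*-identityʳ (f 0)) f₀) (trans (ℤ.*-identityˡ (g 1)) (proj₂ (x-over-f-low-coeffs f g f₀ gf≈X)))
pow-mul-deriv-x-over-f-coeff f g f₀ gf≈X (suc q) = +ℤ-cancelʳ Z _ _ (begin
  Y +ℤ Z                                                          ≡⟨ cong (Y +ℤ_) (mul-X-suc (mul (pow f q) (deriv f)) q) ⟨
  add (mul (pow f (suc (suc q))) (deriv g)) (mul X (mul (pow f q) (deriv f))) (suc q)
                                                                  ≡⟨ pow-mul-deriv-x-over-f f g gf≈X q (suc q) ⟩
  pow f (suc q) (suc q)                                           ≡⟨ ℤ.*-cancelˡ-≡ (+ suc q) _ _ (deriv-pow f q q) ⟩
  Z                                                               ≡⟨ ℤ.+-identityˡ Z ⟨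
  0ℤ +ℤ Z                                                         ∎)
  where
  open ≡-Reasoning
  Y Z : ℤ
  Y = mul (pow f (suc (suc q))) (deriv g) (suc q)
  Z = mul (pow f q) (deriv f) q

mul-pow-xf : ∀ f n → mul f (pow (mul X f) n) ≈ₛ mul (pow X n) (pow f (suc n))
mul-pow-xf f n = ≈ₛ-trans (mul-congʳ f (pow-distrib-mul X f n))
  (solve 3 (λ f xⁿ fⁿ → f ⊕ (xⁿ ⊕ fⁿ) ⊜ xⁿ ⊕ (f ⊕ fⁿ)) ≈ₛ-refl f (pow X n) (pow f n))
  where open ⊛-Solver

x-over-f-column-coeff : ∀ f g → f 0 ≡ 1ℤ → mul g f ≈ₛ X → ∀ n k →
  mul (mul (deriv g) (pow g k)) (mul f (pow (mul X f) n)) (n + n) ≡ idMat n k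
x-over-f-column-coeff f g f₀ gf≈X n k with k ≤? n
... | yes k≤n = subst (λ m → W m (m + m) ≡ idMat m k) (m+[n∸m]≡n k≤n) (diagonal (n ∸ k))
  where
  W : ℕ → Series
  W m = mul (mul (deriv g) (pow g k)) (mul f (pow (mul X f) m))
  -- The point is that g^k f^k = (g f)^k = x^k.
  W≈ : ∀ p → W (k + p) ≈ₛ mul (pow X ((k + p) + k)) (mul (pow f (suc p)) (deriv g))
  W≈ p = begin
    W (k + p)
      ≈⟨ mul-congʳ (mul (deriv g) (pow g k)) (≈ₛ-trans (mul-pow-xf f (k + p))
           (mul-congʳ (pow X (k + p)) (≈ₛ-trans (λ m → cong (λ i → pow f i m) (sym (+-suc k p))) (pow-+ f k (suc p))))) ⟩
    mul (mul (deriv g) (pow g k)) (mul (pow X (k + p)) (mul (pow f k) (pow f (suc p))))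
      ≈⟨ solve 5 (λ g′ gᵏ xⁿ fᵏ f¹⁺ᵖ → (g′ ⊕ gᵏ) ⊕ (xⁿ ⊕ (fᵏ ⊕ f¹⁺ᵖ)) ⊜ (xⁿ ⊕ (gᵏ ⊕ fᵏ)) ⊕ (f¹⁺ᵖ ⊕ g′)) ≈ₛ-refl
           (deriv g) (pow g k) (pow X (k + p)) (pow f k) (pow f (suc p)) ⟩
    mul (mul (pow X (k + p)) (mul (pow g k) (pow f k))) (mul (pow f (suc p)) (deriv g))
      ≈⟨ mul-congˡ (mul (pow f (suc p)) (deriv g))
           (mul-congʳ (pow X (k + p)) (≈ₛ-trans (≈ₛ-sym (pow-distrib-mul g f k)) (pow-cong k gf≈X))) ⟩
    mul (mul (pow X (k + p)) (pow X k)) (mul (pow f (suc p)) (deriv g))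
      ≈⟨ mul-congˡ (mul (pow f (suc p)) (deriv g)) (pow-+ X (k + p) k) ⟨
    mul (pow X ((k + p) + k)) (mul (pow f (suc p)) (deriv g))
      ∎
    where
    open ≈ₛ-Reasoning
    open ⊛-Solver
  diagonal : ∀ p → W (k + p) ((k + p) + (k + p)) ≡ idMat (k + p) k
  diagonal p = begin
    W (k + p) ((k + p) + (k + p))                                   ≡⟨ cong (W (k + p)) (+-assoc (k + p) k p) ⟨
    W (k + p) (((k + p) + k) + p)                                   ≡⟨ W≈ p (((k + p) + k) + p) ⟩
    mul (pow X ((k + p) + k)) (mul (pow f (suc p)) (deriv g)) (((k + p) + k) + p)
                                                                    ≡⟨ mul-pow-X ((k + p) + k) p (mul (pow f (suc p)) (deriv g)) ⟩
    mul (pow f (suc p)) (deriv g) p                                 ≡⟨ pow-mul-deriv-x-over-f-coeff f g f₀ gf≈X p ⟩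
    one p                                                           ≡⟨ idMat-+ k p ⟨
    idMat (k + p) k                                                 ∎
    where open ≡-Reasoning
... | no k≰n = trans
  (mul-orderAtLeast {mul (deriv g) (pow g k)} {mul f (pow (mul X f) n)} {k} {n}
     (mul-orderAtLeast {deriv g} {pow g k} {0} {k} (orderAtLeast-0 (deriv g)) (pow-orderAtLeast k g₀))
     (mul-orderAtLeast {f} {pow (mul X f) n} {0} {n} (orderAtLeast-0 f) (pow-orderAtLeast n refl))
     (n + n) (+-monoˡ-< n (≰⇒> k≰n)))
  (sym (idMat-off n k (λ { refl → k≰n ≤-refl })))
  where
  g₀ : g 0 ≡ 0ℤ
  g₀ = proj₁ (x-over-f-low-coeffs f g f₀ gf≈X)

-- The inverse of c(A; 1)

module BellInverse
    (f : Series) (f₀ : f 0 ≡ 1ℤ)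
    (g : Series) (gf≈X : mul g f ≈ₛ X)
    (φ : Series) (φ-rev : IsReversion g φ)
    (v̄ : Series) (v̄-rev : IsReversion (mul X f) v̄)
    (ψ : Series) (ψf[v̄]≈v̄ : mul ψ (comp f v̄) ≈ₛ v̄)
    (d : Series) (dφ′[ψ]≈1 : mul d (comp (deriv φ) ψ) ≈ₛ one)
  where

  v h : Series
  v = mul X f
  h = mul φ (comp f φ)

  C D T : Matrix
  C = cA1 f
  D = riordan d ψ
  T = riordan (deriv φ) h

  g₀ : g 0 ≡ 0ℤ
  g₀ = proj₁ (x-over-f-low-coeffs f g f₀ gf≈X)

  φ₀ : φ 0 ≡ 0ℤ
  φ₀ = proj₁ φ-rev

  v̄₀ : v̄ 0 ≡ 0ℤ
  v̄₀ = proj₁ v̄-rev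

  φ∘g≈X : comp φ g ≈ₛ X
  φ∘g≈X = reversion-left-inverse g φ g₀ (proj₂ (x-over-f-low-coeffs f g f₀ gf≈X)) φ-rev

  v̄∘v≈X : comp v̄ v ≈ₛ X
  v̄∘v≈X = reversion-left-inverse v v̄ refl (trans (mul-X-suc f 0) f₀) v̄-rev

  ψ≈g∘v̄ : ψ ≈ₛ comp g v̄
  ψ≈g∘v̄ = mul-cancelʳ ψ (comp g v̄) (comp f v̄) (trans (comp-coeff-0 f v̄) f₀) (begin
    mul ψ (comp f v̄)            ≈⟨ ψf[v̄]≈v̄ ⟩
    v̄                           ≈⟨ comp-identityˡ v̄ v̄₀ ⟨
    comp X v̄                    ≈⟨ comp-congˡ v̄ gf≈X ⟨
    comp (mul g f) v̄            ≈⟨ comp-mul g f v̄ v̄₀ ⟩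
    mul (comp g v̄) (comp f v̄)  ∎)
    where open ≈ₛ-Reasoning

  ψ₀ : ψ 0 ≡ 0ℤ
  ψ₀ = trans (ψ≈g∘v̄ 0) (trans (comp-coeff-0 g v̄) g₀)

  φ∘ψ≈v̄ : comp φ ψ ≈ₛ v̄
  φ∘ψ≈v̄ = begin
    comp φ ψ           ≈⟨ comp-congʳ φ ψ≈g∘v̄ ⟩
    comp φ (comp g v̄)  ≈⟨ comp-assoc φ g v̄ g₀ v̄₀ ⟨
    comp (comp φ g) v̄  ≈⟨ comp-congˡ v̄ φ∘g≈X ⟩
    comp X v̄           ≈⟨ comp-identityˡ v̄ v̄₀ ⟩
    v̄                  ∎
    where open ≈ₛ-Reasoning

  ψ∘v≈g : comp ψ v ≈ₛ g
  ψ∘v≈g = begin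
    comp ψ v           ≈⟨ comp-congˡ v ψ≈g∘v̄ ⟩
    comp (comp g v̄) v  ≈⟨ comp-assoc g v̄ v v̄₀ refl ⟩
    comp g (comp v̄ v)  ≈⟨ comp-congʳ g v̄∘v≈X ⟩
    comp g X           ≈⟨ comp-identityʳ g ⟩
    g                  ∎
    where open ≈ₛ-Reasoning

  -- Both d(v) and g' are inverse to φ'(g): the first by hypothesis, the second by the chain rule on φ(g) = x.
  d∘v≈g′ : comp d v ≈ₛ deriv g
  d∘v≈g′ = begin
    comp d v                                         ≈⟨ mul-identityʳ (comp d v) ⟨
    mul (comp d v) one                               ≈⟨ mul-congʳ (comp d v) φ′[g]g′≈1 ⟨
    mul (comp d v) (mul (comp (deriv φ) g) (deriv g)) ≈⟨ mul-assoc (comp d v) (comp (deriv φ) g) (deriv g) ⟨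
    mul (mul (comp d v) (comp (deriv φ) g)) (deriv g) ≈⟨ mul-congˡ (deriv g) d[v]φ′[g]≈1 ⟩
    mul one (deriv g)                                ≈⟨ mul-identityˡ (deriv g) ⟩
    deriv g                                          ∎
    where
    open ≈ₛ-Reasoning
    φ′[g]g′≈1 : mul (comp (deriv φ) g) (deriv g) ≈ₛ one
    φ′[g]g′≈1 = ≈ₛ-trans (≈ₛ-sym (deriv-comp φ g g₀)) (≈ₛ-trans (deriv-cong φ∘g≈X) deriv-X)
    d[v]φ′[g]≈1 : mul (comp d v) (comp (deriv φ) g) ≈ₛ one
    d[v]φ′[g]≈1 = begin
      mul (comp d v) (comp (deriv φ) g)            ≈⟨ mul-congʳ (comp d v) (comp-congʳ (deriv φ) ψ∘v≈g) ⟨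
      mul (comp d v) (comp (deriv φ) (comp ψ v))   ≈⟨ mul-congʳ (comp d v) (comp-assoc (deriv φ) ψ v ψ₀ refl) ⟨
      mul (comp d v) (comp (comp (deriv φ) ψ) v)   ≈⟨ comp-mul d (comp (deriv φ) ψ) v refl ⟨
      comp (mul d (comp (deriv φ) ψ)) v            ≈⟨ comp-congˡ v dφ′[ψ]≈1 ⟩
      comp one v                                   ≈⟨ comp-one v ⟩
      one                                          ∎

  h∘ψ≈X : comp h ψ ≈ₛ X
  h∘ψ≈X = begin
    comp h ψ
      ≈⟨ comp-mul φ (comp f φ) ψ ψ₀ ⟩
    mul (comp φ ψ) (comp (comp f φ) ψ)
      ≈⟨ mul-cong {comp φ ψ} {v̄} φ∘ψ≈v̄ (≈ₛ-trans (comp-assoc f φ ψ φ₀ ψ₀) (comp-congʳ f φ∘ψ≈v̄)) ⟩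
    mul v̄ (comp f v̄)
      ≈⟨ mul-congˡ (comp f v̄) (comp-identityˡ v̄ v̄₀) ⟨
    mul (comp X v̄) (comp f v̄)
      ≈⟨ comp-mul X f v̄ v̄₀ ⟨
    comp v v̄
      ≈⟨ proj₂ v̄-rev ⟩
    X
      ∎
    where open ≈ₛ-Reasoning

  D·T≈I : matMul D T ≈ₘ idMat
  D·T≈I = begin
    matMul D T                                     ≈⟨ riordan-matMul d ψ (deriv φ) h ψ₀ ⟩
    riordan (mul d (comp (deriv φ) ψ)) (comp h ψ)  ≈⟨ riordan-cong {mul d (comp (deriv φ) ψ)} {one} dφ′[ψ]≈1 h∘ψ≈X ⟩
    riordan one X                                  ≈⟨ riordan-identity ⟩
    idMat                                          ∎
    where open ≈ₘ-Reasoning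

  C·D≈I : matMul C D ≈ₘ idMat
  C·D≈I n k = begin
    matMul C D n k
      ≡⟨ cA1-matMul-riordan f d ψ n k ⟩
    mul (comp (mul d (pow ψ k)) v) (mul f (pow v n)) (n + n)
      ≡⟨ mul-congˡ (mul f (pow v n)) column∘v (n + n) ⟩
    mul (mul (deriv g) (pow g k)) (mul f (pow v n)) (n + n)
      ≡⟨ x-over-f-column-coeff f g f₀ gf≈X n k ⟩
    idMat n k
      ∎
    where
    open ≡-Reasoning
    column∘v : comp (mul d (pow ψ k)) v ≈ₛ mul (deriv g) (pow g k)
    column∘v = ≈ₛ-trans (comp-mul d (pow ψ k) v refl)
      (mul-cong {comp d v} {deriv g} d∘v≈g′ (≈ₛ-trans (comp-pow ψ v refl k) (pow-cong k ψ∘v≈g)))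

  C≈T : C ≈ₘ T
  C≈T = begin
    C                     ≈⟨ matMul-identityʳ C (cA1-lowerTriangular f) ⟨
    matMul C idMat        ≈⟨ matMul-cong {C} {C} ≈ₘ-refl D·T≈I ⟨
    matMul C (matMul D T) ≈⟨ matMul-assoc C D T (riordan-lowerTriangular d ψ ψ₀) ⟨
    matMul (matMul C D) T ≈⟨ matMul-cong {matMul C D} {idMat} {T} C·D≈I ≈ₘ-refl ⟩
    matMul idMat T        ≈⟨ matMul-identityˡ T ⟩
    T                     ∎
    where open ≈ₘ-Reasoning

  D·C≈I : matMul D C ≈ₘ idMat
  D·C≈I = ≈ₘ-trans (matMul-cong {D} {D} {C} {T} ≈ₘ-refl C≈T) D·T≈I

mainTheorem5 : (f : Series) → f 0 ≡ + 1 →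
    (g : Series) → mul g f ≈ₛ X →
    (φ : Series) → IsReversion g φ →
    (vb : Series) → IsReversion (mul X f) vb →
    (ψ : Series) → mul ψ (comp f vb) ≈ₛ vb →
    (d : Series) → mul d (comp (deriv φ) ψ) ≈ₛ one →
    (cA1 f ≈ₘ riordan (deriv φ) (mul φ (comp f φ)))
    × (matMul (cA1 f) (riordan d ψ) ≈ₘ idMat)
    × (matMul (riordan d ψ) (cA1 f) ≈ₘ idMat)
mainTheorem5 f f₀ g gf≈X φ φ-rev vb vb-rev ψ ψf[vb]≈vb d dφ′[ψ]≈1 = C≈T , C·D≈I , D·C≈I
  where open BellInverse f f₀ g gf≈X φ φ-rev vb vb-rev ψ ψf[vb]≈vb d dφ′[ψ]≈1
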